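{- Let $N\in\mathbb{N}$ and $R\subseteq\mathbb{N}^{N+1}$. Then $\vec{\forall}(R^*)=\vec{\forall}R$.
   Context: For $R\subseteq\mathbb{N}^{N+1}$: $\vec{\forall}R=\{n\in\mathbb{N}:\forall x_1\exists x_2\forall x_3\cdots Qx_N\ R(n,x_1,\ldots,x_N)\}$ (alternating quantifiers), and $R^*=\{(n,x_1,\ldots,x_N)\in\mathbb{N}^{N+1}:\forall x_1'\le x_1\ \exists x_2'\le x_2\cdots Qx_N'\le x_N\ R(n,x_1',\ldots,x_N')\}$ (alternating bounded quantifiers starting with $\forall$). -}

module Defs where

open import Data.Nat using (ℕ; _≤_)
open import Data.Vec using (Vec; []; _∷_)
open import Data.Product using (Σ; _×_)
open import Data.Sum using (_⊎_)
open import Relation.Nullary using (¬_)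

mutual
  AllAlt : (k : ℕ) → (Vec ℕ k → Set) → Set
  AllAlt ℕ.zero    P = P []
  AllAlt (ℕ.suc k) P = (x : ℕ) → ExAlt k (λ xs → P (x ∷ xs))

  ExAlt : (k : ℕ) → (Vec ℕ k → Set) → Set
  ExAlt ℕ.zero    P = P []
  ExAlt (ℕ.suc k) P = Σ ℕ (λ x → AllAlt k (λ xs → P (x ∷ xs)))

mutual
  BAllAlt : {k : ℕ} → Vec ℕ k → (Vec ℕ k → Set) → Set
  BAllAlt []       P = P []
  BAllAlt (b ∷ bs) P = (x : ℕ) → x ≤ b → BExAlt bs (λ xs → P (x ∷ xs))

  BExAlt : {k : ℕ} → Vec ℕ k → (Vec ℕ k → Set) → Set
  BExAlt []       P = P []
  BExAlt (b ∷ bs) P = Σ ℕ (λ x → x ≤ b × BAllAlt bs (λ xs → P (x ∷ xs)))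

-- A relation R ⊆ ℕ^{N+1}, written R n (x₁,…,x_N).
Rel : ℕ → Set₁
Rel N = ℕ → Vec ℕ N → Set

star : {N : ℕ} → Rel N → Rel N
star R n xs = BAllAlt xs (R n)

forallVec : {N : ℕ} → Rel N → ℕ → Set
forallVec {N} R n = AllAlt N (R n)

-- Law of excluded middle (the paper's ambient classical logic).
LEM : Set₁
LEM = (P : Set) → P ⊎ ¬ P

-- ∀⃗R ⊆ ∀⃗R*: more generally, a finite conjunction of alternating sentences
-- ∀x₁∃x₂… Pᵢ implies ∀x₁∃x₂… ⋀ᵢ Pᵢ*, by induction on the prefix with the dual
-- statement for ∃-prefixes; an ∃ collects the witnesses of all conjuncts under
-- their maximum, and a ∀ turns each conjunct into its sections x₁′ ≤ x₁.
-- ∀⃗R* ⊆ ∀⃗R: otherwise classically ∃x₁∀x₂… ¬R, hence by the dual bounded form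
-- ∃x₁∀x₂… (¬R)* with ∃x₁′ ≤ x₁ ∀x₂′ ≤ x₂ …; playing this against ∀⃗R* at the
-- same point yields a tuple satisfying both R and ¬R.
module Submission where

open import Defs
open import Data.Nat using (ℕ; zero; suc; _≤_; _⊔_; s≤s; s≤s⁻¹)
open import Data.Nat.Properties using (m≤m⊔n; m≤n⇒m≤o⊔n)
open import Data.List using (List; []; _∷_; [_]; concatMap; applyUpTo)
open import Data.List.Relation.Unary.All as All using (All; []; _∷_)
open import Data.List.Relation.Unary.All.Properties using (concat⁺; concat⁻; map⁺; map⁻; applyUpTo⁺₁; applyUpTo⁻)
open import Data.Vec using (Vec; []; _∷_)
open import Data.Product using (∃; _×_; _,_; uncurry)
open import Data.Sum using (_⊎_; inj₁; inj₂)
open import Data.Unit using (⊤; tt)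
open import Data.Empty using (⊥-elim)
open import Function.Bundles using (_⇔_; mk⇔)
open import Relation.Nullary using (¬_)

VecPred : ℕ → Set₁
VecPred k = Vec ℕ k → Set

mutual
  AllAlt-map : ∀ k {P Q : VecPred k} → (∀ xs → P xs → Q xs) → AllAlt k P → AllAlt k Q
  AllAlt-map zero    f h   = f [] h
  AllAlt-map (suc k) f h x = ExAlt-map k (λ xs → f (x ∷ xs)) (h x)

  ExAlt-map : ∀ k {P Q : VecPred k} → (∀ xs → P xs → Q xs) → ExAlt k P → ExAlt k Q
  ExAlt-map zero    f h       = f [] h
  ExAlt-map (suc k) f (x , h) = x , AllAlt-map k (λ xs → f (x ∷ xs)) h

mutual
  AllAlt-ExAlt-overlap : ∀ k {P Q : VecPred k} → AllAlt k P → ExAlt k Q → ∃ λ xs → P xs × Q xs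
  AllAlt-ExAlt-overlap zero    p q       = [] , p , q
  AllAlt-ExAlt-overlap (suc k) p (x , q) with ExAlt-AllAlt-overlap k (p x) q
  ... | xs , px , qx = x ∷ xs , px , qx

  ExAlt-AllAlt-overlap : ∀ k {P Q : VecPred k} → ExAlt k P → AllAlt k Q → ∃ λ xs → P xs × Q xs
  ExAlt-AllAlt-overlap zero    p       q = [] , p , q
  ExAlt-AllAlt-overlap (suc k) (x , p) q with AllAlt-ExAlt-overlap k p (q x)
  ... | xs , px , qx = x ∷ xs , px , qx

mutual
  BAllAlt-BExAlt-overlap : ∀ {k} {P Q : VecPred k} (bs : Vec ℕ k) → BAllAlt bs P → BExAlt bs Q →
    ∃ λ xs → P xs × Q xs
  BAllAlt-BExAlt-overlap []       p q             = [] , p , q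
  BAllAlt-BExAlt-overlap (b ∷ bs) p (x , x≤b , q) with BExAlt-BAllAlt-overlap bs (p x x≤b) q
  ... | xs , px , qx = x ∷ xs , px , qx

  BExAlt-BAllAlt-overlap : ∀ {k} {P Q : VecPred k} (bs : Vec ℕ k) → BExAlt bs P → BAllAlt bs Q →
    ∃ λ xs → P xs × Q xs
  BExAlt-BAllAlt-overlap []       p             q = [] , p , q
  BExAlt-BAllAlt-overlap (b ∷ bs) (x , x≤b , p) q with BAllAlt-BExAlt-overlap bs p (q x x≤b)
  ... | xs , px , qx = x ∷ xs , px , qx

¬∀⇒∃¬ : LEM → {Φ : ℕ → Set} → ¬ (∀ x → Φ x) → ∃ λ x → ¬ Φ x
¬∀⇒∃¬ lem {Φ} ¬∀ with lem (∃ λ x → ¬ Φ x)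
... | inj₁ ∃¬  = ∃¬
... | inj₂ ¬∃¬ = ⊥-elim (¬∀ λ x → decided x (lem (Φ x)))
  where
  decided : ∀ x → Φ x ⊎ ¬ Φ x → Φ x
  decided x (inj₁ φ)  = φ
  decided x (inj₂ ¬φ) = ⊥-elim (¬∃¬ (x , ¬φ))

mutual
  ¬AllAlt⇒ExAlt¬ : LEM → ∀ k {P : VecPred k} → ¬ AllAlt k P → ExAlt k (λ xs → ¬ P xs)
  ¬AllAlt⇒ExAlt¬ lem zero    ¬p = ¬p
  ¬AllAlt⇒ExAlt¬ lem (suc k) ¬p with ¬∀⇒∃¬ lem ¬p
  ... | x , ¬px = x , ¬ExAlt⇒AllAlt¬ lem k ¬px

  ¬ExAlt⇒AllAlt¬ : LEM → ∀ k {P : VecPred k} → ¬ ExAlt k P → AllAlt k (λ xs → ¬ P xs)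
  ¬ExAlt⇒AllAlt¬ lem zero    ¬p   = ¬p
  ¬ExAlt⇒AllAlt¬ lem (suc k) ¬p x = ¬AllAlt⇒ExAlt¬ lem k (λ px → ¬p (x , px))

module _ {I : Set} where

  indicesUpTo : ℕ → List I → List (I × ℕ)
  indicesUpTo x = concatMap (λ i → applyUpTo (i ,_) (suc x))

  module _ {Q : I × ℕ → Set} {x : ℕ} {is : List I} where

    All-indicesUpTo⁺ : All (λ i → ∀ x′ → x′ ≤ x → Q (i , x′)) is → All Q (indicesUpTo x is)
    All-indicesUpTo⁺ h =
      concat⁺ (map⁺ (All.map (λ {i} f → applyUpTo⁺₁ (i ,_) (suc x) (λ {x′} x′<1+x → f x′ (s≤s⁻¹ x′<1+x))) h))

    All-indicesUpTo⁻ : All Q (indicesUpTo x is) → All (λ i → ∀ x′ → x′ ≤ x → Q (i , x′)) is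
    All-indicesUpTo⁻ h =
      All.map (λ {i} all x′ x′≤x → applyUpTo⁻ (i ,_) (suc x) all (s≤s x′≤x)) (map⁻ (concat⁻ h))

  module _ {F : I → ℕ → Set} where

    withWitnesses : (is : List I) → All (λ i → ∃ (F i)) is → List (I × ℕ)
    withWitnesses []       []             = []
    withWitnesses (i ∷ is) ((w , _) ∷ ws) = (i , w) ∷ withWitnesses is ws

    witnessBound : (is : List I) → All (λ i → ∃ (F i)) is → ℕ
    witnessBound []       []             = 0
    witnessBound (_ ∷ is) ((w , _) ∷ ws) = w ⊔ witnessBound is ws

    All-withWitnesses : (is : List I) (ws : All (λ i → ∃ (F i)) is) → All (uncurry F) (withWitnesses is ws)
    All-withWitnesses []       []             = []
    All-withWitnesses (_ ∷ is) ((_ , f) ∷ ws) = f ∷ All-withWitnesses is ws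

    All-withWitnesses⁻ : {G : I × ℕ → Set} (is : List I) (ws : All (λ i → ∃ (F i)) is) →
      All G (withWitnesses is ws) → All (λ i → ∃ λ x′ → x′ ≤ witnessBound is ws × G (i , x′)) is
    All-withWitnesses⁻ []       []             []       = []
    All-withWitnesses⁻ (_ ∷ is) ((w , _) ∷ ws) (g ∷ gs) =
      (w , m≤m⊔n w _ , g) ∷
      All.map (λ { (x′ , x′≤m , gx′) → x′ , m≤n⇒m≤o⊔n w x′≤m , gx′ }) (All-withWitnesses⁻ is ws gs)

sectionOf : {k : ℕ} {I : Set} → (I → VecPred (suc k)) → I × ℕ → VecPred k
sectionOf ψ (i , x) xs = ψ i (x ∷ xs)

-- Conjuncts are indexed by a list over a small index type rather than listed as
-- predicates, so that the conjunction stays in Set.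
mutual
  All-AllAlt⇒AllAlt-BAllAlt : ∀ k {I : Set} (ψ : I → VecPred k) (is : List I) →
    All (λ i → AllAlt k (ψ i)) is → AllAlt k (λ xs → All (λ i → BAllAlt xs (ψ i)) is)
  All-AllAlt⇒AllAlt-BAllAlt zero    ψ is h   = h
  All-AllAlt⇒AllAlt-BAllAlt (suc k) ψ is h x =
    ExAlt-map k (λ _ → All-indicesUpTo⁻)
      (All-ExAlt⇒ExAlt-BExAlt k (sectionOf ψ) (indicesUpTo x is)
        (All-indicesUpTo⁺ (All.map (λ p x′ _ → p x′) h)))

  All-ExAlt⇒ExAlt-BExAlt : ∀ k {I : Set} (ψ : I → VecPred k) (is : List I) →
    All (λ i → ExAlt k (ψ i)) is → ExAlt k (λ xs → All (λ i → BExAlt xs (ψ i)) is)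
  All-ExAlt⇒ExAlt-BExAlt zero    ψ is h  = h
  All-ExAlt⇒ExAlt-BExAlt (suc k) ψ is ws =
    witnessBound is ws ,
    AllAlt-map k (λ _ → All-withWitnesses⁻ is ws)
      (All-AllAlt⇒AllAlt-BAllAlt k (sectionOf ψ) (withWitnesses is ws) (All-withWitnesses is ws))

AllAlt⇒AllAlt-BAllAlt : ∀ k {P : VecPred k} → AllAlt k P → AllAlt k (λ xs → BAllAlt xs P)
AllAlt⇒AllAlt-BAllAlt k {P} p =
  AllAlt-map k (λ _ → All.head) (All-AllAlt⇒AllAlt-BAllAlt k (λ (_ : ⊤) → P) [ tt ] (p ∷ []))

ExAlt⇒ExAlt-BExAlt : ∀ k {P : VecPred k} → ExAlt k P → ExAlt k (λ xs → BExAlt xs P)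
ExAlt⇒ExAlt-BExAlt k {P} p =
  ExAlt-map k (λ _ → All.head) (All-ExAlt⇒ExAlt-BExAlt k (λ (_ : ⊤) → P) [ tt ] (p ∷ []))

AllAlt-BAllAlt⇒AllAlt : LEM → ∀ k {P : VecPred k} → AllAlt k (λ xs → BAllAlt xs P) → AllAlt k P
AllAlt-BAllAlt⇒AllAlt lem k {P} p* with lem (AllAlt k P)
... | inj₁ p  = p
... | inj₂ ¬p with AllAlt-ExAlt-overlap k p* (ExAlt⇒ExAlt-BExAlt k (¬AllAlt⇒ExAlt¬ lem k ¬p))
...   | bs , bounded , counter with BAllAlt-BExAlt-overlap bs bounded counter
...     | _ , px , ¬px = ⊥-elim (¬px px)

lemma3p7 : LEM → (N : ℕ) (R : Rel N) (n : ℕ) →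
    forallVec (star R) n ⇔ forallVec R n
lemma3p7 lem N R n = mk⇔ (AllAlt-BAllAlt⇒AllAlt lem N) (AllAlt⇒AllAlt-BAllAlt N)
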